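{- Let $p=(p_i)_{i=1}^n$, $q=(q_i)_{i=1}^n$ be lattice paths with $p\preceq q$ such that the strong lattice path matroid $M=M[p,q]$ on $E=\{1,\ldots,n\}$ has no loops and no parallel elements, and $\operatorname{rk}_M(E)\ge 2$. Let $N_q=\{i\in E\mid q_i=\mathrm{N}\}$, $j_1=\max N_q$, and $j_2=\max(N_q\setminus\{j_1\})$. Then: (i) $W=\{1,2,\ldots,j_2-1\}$ is a coline of $M$ (called the Western coline of $M$). (ii) $\{1,2,\ldots,j_1-1\}$ is a copoint on $W$, and it is a multiple copoint on $W$ whenever $j_1-j_2\ge 2$. (iii) For every $k\in E$ with $k\ge j_1$, the set $W\cup\{k\}$ is a simple copoint on $W$.
   Context: A lattice path of length $n$ is a tuple $(r_i)_{i=1}^n\in\{\mathrm{N},\mathrm{E}\}^n$. For lattice paths $p,q$ of length $n$, we write $p\preceq q$ if for all $k$, $|\{i\le k\mid p_i=\mathrm{N}\}|\le|\{i\le k\mid q_i=\mathrm{N}\}|$, with equality for $k=n$. $\mathrm{P}[p,q]=\{r\mid p\preceq r\preceq q\}$. For $p\preceq q$, the strong lattice path matroid $M[p,q]$ is the transversal matroid on $\{1,\ldots,n\}$ presented by the family $(A_i)_{i=1}^m$, $m=|\{i\mid q_i=\mathrm{N}\}|$, where $A_i$ is the set of $j$ such that some $r\in\mathrm{P}[p,q]$ has $r_j=\mathrm{N}$ and $|\{k\le j\mid r_k=\mathrm{N}\}|=i$. A coline of a matroid $M$ on $E$ is a flat $X$ with $\operatorname{rk}_M(X)=\operatorname{rk}_M(E)-2$.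 A copoint on a coline $X$ is a flat $Y\supseteq X$ with $\operatorname{rk}_M(Y)=\operatorname{rk}_M(E)-1$; it is simple if $|Y\setminus X|=1$ and multiple if $|Y\setminus X|>1$. -}

module Defs where

open import Data.Nat using (ℕ; zero; suc; _+_; _≤_; _<_; _∸_; _<?_)
open import Data.Fin using (Fin; toℕ)
import Data.Fin as F
open import Data.Fin.Subset public
  using (Subset; _∈_; _∉_; _⊆_; ⁅_⁆; _∪_; _∩_; ∁; ∣_∣)
open import Data.Fin.Subset as S using ()
open import Data.Vec using (tabulate)
open import Data.Product using (Σ; _×_)
open import Relation.Binary.PropositionalEquality using (_≡_; _≢_)
open import Relation.Nullary using (¬_; does)
open import Function using (_∘_)

data Step : Set where
  N E : Step

-- A lattice path of length n; position i : Fin n (0-based) is the paper's step i+1.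
Path : ℕ → Set
Path n = Fin n → Step

isN : Step → ℕ
isN N = 1
isN E = 0

-- countN r k = |{ i ≤ k | r_i = N }| (paper's 1-based indices; saturates for k ≥ n)
countN : ∀ {n} → Path n → ℕ → ℕ
countN {zero}  r k       = 0
countN {suc n} r zero    = 0
countN {suc n} r (suc k) = isN (r F.zero) + countN (r ∘ F.suc) k

_⪯_ : ∀ {n} → Path n → Path n → Set
_⪯_ {n} p q = ((k : ℕ) → countN p k ≤ countN q k) × (countN p n ≡ countN q n)

-- number of sets in the presentation: m = |{ i | q_i = N }|
rkq : ∀ {n} → Path n → ℕ
rkq {n} q = countN q n

-- A p q i j : element j (0-based, paper's j+1) lies in A_{i+1} (i : Fin m, 0-based)
A : ∀ {n} (p q : Path n) → Fin (rkq q) → Fin n → Set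
A p q i j = Σ (Path _) λ r → (p ⪯ r) × (r ⪯ q) × (r j ≡ N)
              × (countN r (suc (toℕ j)) ≡ suc (toℕ i))

-- Independent sets of the transversal matroid M[p,q]: partial transversals
Indep : ∀ {n} (p q : Path n) → Subset n → Set
Indep {n} p q I = Σ (Fin n → Fin (rkq q)) λ f →
  ((x y : Fin n) → x ∈ I → y ∈ I → f x ≡ f y → x ≡ y) ×
  ((x : Fin n) → x ∈ I → A p q (f x) x)

Rank : ∀ {n} (p q : Path n) → Subset n → ℕ → Set
Rank p q X r =
  (Σ (Subset _) λ I → I ⊆ X × Indep p q I × ∣ I ∣ ≡ r) ×
  ((I : Subset _) → I ⊆ X → Indep p q I → ∣ I ∣ ≤ r)

Flat : ∀ {n} (p q : Path n) → Subset n → Set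
Flat p q X = ∀ e → e ∉ X → ∀ r r' → Rank p q X r → Rank p q (X ∪ ⁅ e ⁆) r' → r < r'

Coline : ∀ {n} (p q : Path n) → Subset n → Set
Coline p q X = Flat p q X × Σ ℕ λ r → Rank p q S.⊤ r × Rank p q X (r ∸ 2)

CopointOn : ∀ {n} (p q : Path n) → Subset n → Subset n → Set
CopointOn p q X Y = Flat p q Y × X ⊆ Y × Σ ℕ λ r → Rank p q S.⊤ r × Rank p q Y (r ∸ 1)

SimpleCopointOn : ∀ {n} (p q : Path n) → Subset n → Subset n → Set
SimpleCopointOn p q X Y = CopointOn p q X Y × ∣ Y ∩ ∁ X ∣ ≡ 1

MultipleCopointOn : ∀ {n} (p q : Path n) → Subset n → Subset n → Set
MultipleCopointOn p q X Y = CopointOn p q X Y × 1 < ∣ Y ∩ ∁ X ∣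

Loopless : ∀ {n} (p q : Path n) → Set
Loopless p q = ∀ e → Indep p q ⁅ e ⁆

NoParallel : ∀ {n} (p q : Path n) → Set
NoParallel p q = ∀ e f → e ≢ f → Indep p q (⁅ e ⁆ ∪ ⁅ f ⁆)

-- Initial segment {x | toℕ x < j}: in paper's 1-based terms, {1, ..., j}
below : ∀ {n} → ℕ → Subset n
below j = tabulate λ x → does (toℕ x <? j)

-- Write c for the number of N-steps of q strictly before the last-but-one
-- N-step j₂; since j₂ < j₁ are the last two N-steps, the presentation has
-- m = c + 2 sets, which is the rank of E.  The proof computes every rank it
-- needs by matching bounds.
--   * Upper bounds: an element x only lies in sets A_i with i at most the
--     number of N-steps of q up to x, so an independent subset of the first s
--     positions has at most countN q s elements (one more if a single extra
--     element is allowed).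
--   * Lower bounds: the N-steps of q before s are matched to their own sets
--     (witnessed by q itself), and can be extended by later elements matched
--     to later sets.
--   * Membership: a "detour" path, following q up to j₂ and then having its
--     remaining two N-steps at chosen positions u < v, shows that elements in
--     [j₂, j₁) lie in A_{c+1}, elements from j₁ on lie in A_{c+2}, and such a
--     late element lies in A_{c+1} as soon as it lies in some A_i with i ≤ c.
-- Flatness of W, {1..j₁-1} and W ∪ {k} then follows by exhibiting, for each
-- outside element, an independent set one larger than the rank.  The file
-- develops path counting, finite subsets, general transversal facts, the
-- detour path, and finally the analysis of the last two N-steps of q.
module Submission where

open import Defs
open import Data.Nat using (ℕ; zero; suc; _≤_; _<_; _+_; _∸_; z≤n; s≤s; _<?_; _≤?_; s≤s⁻¹)
open import Data.Nat.Properties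
open import Data.Fin using (Fin; toℕ; fromℕ<)
import Data.Fin as F
import Data.Fin.Properties as FP
open import Data.Fin.Subset using (Subset; inside; outside; ⊥; ⊤; _-_)
open import Data.Fin.Subset.Properties
open import Data.Vec using ([]; _∷_; _[_]=_)
open import Data.Vec.Properties using (lookup∘tabulate; lookup⇒[]=; []=⇒lookup)
open import Data.Product using (Σ; _×_; _,_; proj₁; proj₂; map₁)
open import Data.Sum using (_⊎_; inj₁; inj₂)
open import Data.Bool using (true)
open import Relation.Binary.PropositionalEquality
open import Relation.Binary.Definitions using (tri<; tri≈; tri>)
open import Relation.Nullary using (does; yes; no; Dec; contradiction)
open import Relation.Nullary.Decidable using (dec-true)
open import Function using (_∘_)
open _[_]=_

countN-zero : ∀ {n} (r : Path n) → countN r 0 ≡ 0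
countN-zero {zero}  r = refl
countN-zero {suc n} r = refl

countN-step : ∀ {n} (r : Path n) (x : Fin n) →
  countN r (suc (toℕ x)) ≡ countN r (toℕ x) + isN (r x)
countN-step {suc n} r F.zero =
  trans (cong (isN (r F.zero) +_) (countN-zero (r ∘ F.suc))) (+-identityʳ _)
countN-step {suc n} r (F.suc x) =
  trans (cong (isN (r F.zero) +_) (countN-step (r ∘ F.suc) x))
        (sym (+-assoc (isN (r F.zero)) _ _))

countN-stepN : ∀ {n} (r : Path n) (x : Fin n) → r x ≡ N →
  countN r (suc (toℕ x)) ≡ suc (countN r (toℕ x))
countN-stepN r x rx =
  trans (countN-step r x) (trans (cong (λ s → countN r (toℕ x) + isN s) rx) (+-comm _ 1))

countN-mono : ∀ {n} (r : Path n) {a b} → a ≤ b → countN r a ≤ countN r b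
countN-mono {zero}  r _ = z≤n
countN-mono {suc n} r {zero} _ = z≤n
countN-mono {suc n} r {suc a} {suc b} (s≤s a≤b) =
  +-monoʳ-≤ (isN (r F.zero)) (countN-mono (r ∘ F.suc) a≤b)

countN-≤-total : ∀ {n} (r : Path n) k → countN r k ≤ countN r n
countN-≤-total {zero}  r k = z≤n
countN-≤-total {suc n} r zero = z≤n
countN-≤-total {suc n} r (suc k) =
  +-monoʳ-≤ (isN (r F.zero)) (countN-≤-total (r ∘ F.suc) k)

isN-¬N : ∀ {s} → s ≢ N → isN s ≡ 0
isN-¬N {N} s≢N = contradiction refl s≢N
isN-¬N {E} s≢N = refl

countN-constant : ∀ {n} (r : Path n) {a b} → a ≤ b →
  (∀ x → a ≤ toℕ x → toℕ x < b → r x ≢ N) → countN r b ≡ countN r a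
countN-constant {zero} r _ _ = refl
countN-constant {suc n} r {zero} {zero} _ _ = refl
countN-constant {suc n} r {zero} {suc b} _ noN =
  trans (cong₂ _+_ (isN-¬N (noN F.zero z≤n (s≤s z≤n)))
          (countN-constant (r ∘ F.suc) z≤n (λ x _ x<b → noN (F.suc x) z≤n (s≤s x<b))))
        (countN-zero (r ∘ F.suc))
countN-constant {suc n} r {suc a} {suc b} (s≤s a≤b) noN =
  cong (isN (r F.zero) +_)
    (countN-constant (r ∘ F.suc) a≤b (λ x a≤x x<b → noN (F.suc x) (s≤s a≤x) (s≤s x<b)))

countN-strict : ∀ {n} (r : Path n) (x : Fin n) {k} → r x ≡ N → toℕ x < k →
  countN r (toℕ x) < countN r k
countN-strict r x rx x<k = ≤-trans (≤-reflexive (sym (countN-stepN r x rx))) (countN-mono r x<k)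

countN-injective : ∀ {n} (r : Path n) (x y : Fin n) → r x ≡ N → r y ≡ N →
  countN r (toℕ x) ≡ countN r (toℕ y) → x ≡ y
countN-injective r x y rx ry same with FP.<-cmp x y
... | tri< x<y _ _ = contradiction same (<⇒≢ (countN-strict r x rx x<y))
... | tri≈ _ x≡y _ = x≡y
... | tri> _ _ y<x = contradiction (sym same) (<⇒≢ (countN-strict r y ry y<x))

countN-agree : ∀ {n} (t r : Path n) {s k} → (∀ x → toℕ x < s → t x ≡ r x) → k ≤ s →
  countN t k ≡ countN r k
countN-agree {zero}  t r _ _ = refl
countN-agree {suc n} t r {s} {zero} _ _ = refl
countN-agree {suc n} t r {suc s} {suc k} agree (s≤s k≤s) =
  cong₂ _+_ (cong isN (agree F.zero (s≤s z≤n)))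
    (countN-agree (t ∘ F.suc) (r ∘ F.suc) (λ x x<s → agree (F.suc x) (s≤s x<s)) k≤s)

nextN : ∀ {n} (r : Path n) a → countN r a < countN r n →
  Σ (Fin n) λ z → a ≤ toℕ z × r z ≡ N × countN r (toℕ z) ≡ countN r a
nextN {zero} r a ()
nextN {suc n} r zero more with r F.zero in r0
... | N = F.zero , z≤n , r0 , refl
... | E with nextN (r ∘ F.suc) zero
               (subst (_< countN (r ∘ F.suc) n) (sym (countN-zero (r ∘ F.suc))) more)
... | z , _ , rz , cz =
  F.suc z , z≤n , rz , trans (cong₂ _+_ (cong isN r0) cz) (countN-zero (r ∘ F.suc))
nextN {suc n} r (suc a) more with nextN (r ∘ F.suc) a (+-cancelˡ-< (isN (r F.zero)) _ _ more)
... | z , a≤z , rz , cz = F.suc z , s≤s a≤z , rz , cong (isN (r F.zero) +_) cz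

injection-size : ∀ {n m} (I : Subset n) (T : Subset m) (f : Fin n → Fin m) →
  (∀ x y → x ∈ I → y ∈ I → f x ≡ f y → x ≡ y) →
  (∀ x → x ∈ I → f x ∈ T) → ∣ I ∣ ≤ ∣ T ∣
injection-size [] T f inj into = z≤n
injection-size (outside ∷ I) T f inj into =
  injection-size I T (f ∘ F.suc)
    (λ x y x∈ y∈ e → FP.suc-injective (inj (F.suc x) (F.suc y) (there x∈) (there y∈) e))
    (λ x x∈ → into (F.suc x) (there x∈))
injection-size (inside ∷ I) T f inj into =
  ≤-trans (s≤s (injection-size I (T - f F.zero) (f ∘ F.suc)
     (λ x y x∈ y∈ e → FP.suc-injective (inj (F.suc x) (F.suc y) (there x∈) (there y∈) e))
     (λ x x∈ → x∈p∧x∉q⇒x∈p─q (into (F.suc x) (there x∈))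
        (λ hit → FP.0≢1+n (inj F.zero (F.suc x) here (there x∈) (sym (x∈⁅y⁆⇒x≡y _ hit)))))))
   (x∈p⇒∣p-x∣<∣p∣ (into F.zero here))

∣∪∣-disjoint : ∀ {n} (P Q : Subset n) → (∀ x → x ∈ P → x ∉ Q) → ∣ P ∪ Q ∣ ≡ ∣ P ∣ + ∣ Q ∣
∣∪∣-disjoint [] [] _ = refl
∣∪∣-disjoint (outside ∷ P) (outside ∷ Q) d = ∣∪∣-disjoint P Q (λ x a b → d (F.suc x) (there a) (there b))
∣∪∣-disjoint (outside ∷ P) (inside ∷ Q) d =
  trans (cong suc (∣∪∣-disjoint P Q (λ x a b → d (F.suc x) (there a) (there b)))) (sym (+-suc _ _))
∣∪∣-disjoint (inside ∷ P) (outside ∷ Q) d = cong suc (∣∪∣-disjoint P Q (λ x a b → d (F.suc x) (there a) (there b)))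
∣∪∣-disjoint (inside ∷ P) (inside ∷ Q) d = contradiction here (d F.zero here)

∣∪∣-≤ : ∀ {n} (P Q : Subset n) → ∣ P ∪ Q ∣ ≤ ∣ P ∣ + ∣ Q ∣
∣∪∣-≤ [] [] = z≤n
∣∪∣-≤ (outside ∷ P) (outside ∷ Q) = ∣∪∣-≤ P Q
∣∪∣-≤ (outside ∷ P) (inside ∷ Q) = ≤-trans (s≤s (∣∪∣-≤ P Q)) (≤-reflexive (sym (+-suc _ _)))
∣∪∣-≤ (inside ∷ P) (outside ∷ Q) = s≤s (∣∪∣-≤ P Q)
∣∪∣-≤ (inside ∷ P) (inside ∷ Q) = s≤s (≤-trans (∣∪∣-≤ P Q) (≤-trans (n≤1+n _) (≤-reflexive (sym (+-suc _ _)))))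

below⁺ : ∀ {n j} (x : Fin n) → toℕ x < j → x ∈ below j
below⁺ {j = j} x x<j =
  lookup⇒[]= x _ (trans (lookup∘tabulate _ x) (dec-true (toℕ x <? j) x<j))

below⁻ : ∀ {n j} (x : Fin n) → x ∈ below j → toℕ x < j
below⁻ {j = j} x x∈ = decided (toℕ x <? j) (trans (sym (lookup∘tabulate _ x)) ([]=⇒lookup x∈))
  where
  decided : (d : Dec (toℕ x < j)) → does d ≡ true → toℕ x < j
  decided (yes x<j) _ = x<j
  decided (no _) ()

∉below : ∀ {n j} (x : Fin n) → x ∉ below j → j ≤ toℕ x
∉below x x∉ = ≮⇒≥ (λ x<j → x∉ (below⁺ x x<j))

∣below∣≤ : ∀ {n} j → ∣ below {n} j ∣ ≤ j
∣below∣≤ {zero} j = z≤n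
∣below∣≤ {suc n} zero = ∣below∣≤ {n} zero
∣below∣≤ {suc n} (suc j) = s≤s (∣below∣≤ {n} j)

added-one : ∀ {n} (X : Subset n) k → k ∉ X → ∣ (X ∪ ⁅ k ⁆) ∩ ∁ X ∣ ≡ 1
added-one X k k∉X = ≤-antisym
  (injection-size new (⊤ {1}) (λ _ → F.zero) (λ x y x∈ y∈ _ → trans (only-k x x∈) (sym (only-k y y∈)))
    (λ _ _ → ∈⊤))
  (injection-size (⊤ {1}) new (λ _ → k) (λ { F.zero F.zero _ _ _ → refl }) (λ _ _ → k-new))
  where
  new : Subset _
  new = (X ∪ ⁅ k ⁆) ∩ ∁ X
  k-new : k ∈ new
  k-new = x∈p∩q⁺ (x∈p∪q⁺ (inj₂ (x∈⁅x⁆ k)) , x∉p⇒x∈∁p k∉X)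
  only-k : ∀ x → x ∈ new → x ≡ k
  only-k x x∈ with x∈p∩q⁻ (X ∪ ⁅ k ⁆) (∁ X) x∈
  ... | x∈X∪k , x∉X with x∈p∪q⁻ X ⁅ k ⁆ x∈X∪k
  ...   | inj₁ x∈X = contradiction x∈X (x∈∁p⇒x∉p x∉X)
  ...   | inj₂ x≡k = x∈⁅y⁆⇒x≡y k x≡k

below-gap : ∀ {n} (a b : Fin n) → 2 + toℕ a ≤ toℕ b → 2 ≤ ∣ below {n} (toℕ b) ∩ ∁ (below (toℕ a)) ∣
below-gap {n} a b gap =
  ≤-trans (≤-reflexive (sym (∣⊤∣≡n 2))) (injection-size ⊤ (below (toℕ b) ∩ ∁ (below (toℕ a))) pick pick-inj into)
  where
  a+1<n : suc (toℕ a) < n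
  a+1<n = <-≤-trans gap (<⇒≤ (FP.toℕ<n b))
  a+1 : Fin n
  a+1 = fromℕ< a+1<n
  a+1-val : toℕ a+1 ≡ suc (toℕ a)
  a+1-val = FP.toℕ-fromℕ< a+1<n
  pick : Fin 2 → Fin n
  pick F.zero    = a
  pick (F.suc _) = a+1
  a≢a+1 : a ≢ a+1
  a≢a+1 a≡a+1 = <⇒≢ (n<1+n (toℕ a)) (trans (cong toℕ a≡a+1) a+1-val)
  pick-inj : ∀ x y → x ∈ ⊤ → y ∈ ⊤ → pick x ≡ pick y → x ≡ y
  pick-inj F.zero F.zero _ _ _ = refl
  pick-inj F.zero (F.suc F.zero) _ _ e = contradiction e a≢a+1
  pick-inj (F.suc F.zero) F.zero _ _ e = contradiction (sym e) a≢a+1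
  pick-inj (F.suc F.zero) (F.suc F.zero) _ _ _ = refl
  in-gap : ∀ x → toℕ a ≤ toℕ x → toℕ x < toℕ b → x ∈ below (toℕ b) ∩ ∁ (below (toℕ a))
  in-gap x a≤x x<b = x∈p∩q⁺ (below⁺ x x<b , x∉p⇒x∈∁p (λ x<a → <⇒≱ (below⁻ x x<a) a≤x))
  into : ∀ x → x ∈ ⊤ → pick x ∈ below (toℕ b) ∩ ∁ (below (toℕ a))
  into F.zero _ = in-gap a ≤-refl (<-trans (n<1+n _) gap)
  into (F.suc F.zero) _ =
    in-gap a+1 (≤-trans (n≤1+n _) (≤-reflexive (sym a+1-val))) (subst (_< toℕ b) (sym a+1-val) gap)

detour : ∀ {n} → Path n → ℕ → Fin n → Fin n → Path n
detour r s u v x with toℕ x <? s | x F.≟ u | x F.≟ v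
... | yes _ | _     | _     = r x
... | no _  | yes _ | _     = N
... | no _  | no _  | yes _ = N
... | no _  | no _  | no _  = E

module Detour {n} (r : Path n) (s : ℕ) (u v : Fin n)
  (s≤u : s ≤ toℕ u) (u<v : toℕ u < toℕ v) where

  T : Path n
  T = detour r s u v

  T-before : ∀ x → toℕ x < s → T x ≡ r x
  T-before x x<s with toℕ x <? s
  ... | yes _   = refl
  ... | no x≮s = contradiction x<s x≮s

  T-u : T u ≡ N
  T-u with toℕ u <? s | u F.≟ u
  ... | yes u<s | _      = contradiction u<s (≤⇒≯ s≤u)
  ... | no _    | yes _  = refl
  ... | no _    | no u≢u = contradiction refl u≢u

  T-v : T v ≡ N
  T-v with toℕ v <? s | v F.≟ u | v F.≟ v
  ... | yes v<s | _     | _      = contradiction v<s (≤⇒≯ (≤-trans s≤u (<⇒≤ u<v)))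
  ... | no _    | yes _ | _      = refl
  ... | no _    | no _  | yes _  = refl
  ... | no _    | no _  | no v≢v = contradiction refl v≢v

  T-elsewhere : ∀ x → s ≤ toℕ x → toℕ x ≢ toℕ u → toℕ x ≢ toℕ v → T x ≢ N
  T-elsewhere x s≤x x≢u x≢v with toℕ x <? s | x F.≟ u | x F.≟ v
  ... | yes x<s | _      | _      = contradiction x<s (≤⇒≯ s≤x)
  ... | no _    | yes x≡u | _     = contradiction (cong toℕ x≡u) x≢u
  ... | no _    | no _   | yes x≡v = contradiction (cong toℕ x≡v) x≢v
  ... | no _    | no _   | no _   = λ ()

  count-before : ∀ k → k ≤ s → countN T k ≡ countN r k
  count-before k k≤s = countN-agree T r T-before k≤s

  count-first : ∀ k → s ≤ k → k ≤ toℕ u → countN T k ≡ countN r s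
  count-first k s≤k k≤u = trans (countN-constant T s≤k quiet) (count-before s ≤-refl)
    where
    quiet : ∀ x → s ≤ toℕ x → toℕ x < k → T x ≢ N
    quiet x s≤x x<k = T-elsewhere x s≤x (<⇒≢ (<-≤-trans x<k k≤u))
                        (<⇒≢ (<-trans (<-≤-trans x<k k≤u) u<v))

  count-middle : ∀ k → toℕ u < k → k ≤ toℕ v → countN T k ≡ suc (countN r s)
  count-middle k u<k k≤v =
    trans (countN-constant T u<k quiet)
          (trans (countN-stepN T u T-u) (cong suc (count-first (toℕ u) s≤u ≤-refl)))
    where
    quiet : ∀ x → suc (toℕ u) ≤ toℕ x → toℕ x < k → T x ≢ N
    quiet x u<x x<k = T-elsewhere x (≤-trans s≤u (<⇒≤ u<x)) (>⇒≢ u<x) (<⇒≢ (<-≤-trans x<k k≤v))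

  count-after : ∀ k → toℕ v < k → countN T k ≡ suc (suc (countN r s))
  count-after k v<k =
    trans (countN-constant T v<k quiet)
          (trans (countN-stepN T v T-v) (cong suc (count-middle (toℕ v) u<v ≤-refl)))
    where
    quiet : ∀ x → suc (toℕ v) ≤ toℕ x → toℕ x < k → T x ≢ N
    quiet x v<x _ = T-elsewhere x (≤-trans s≤u (≤-trans (<⇒≤ u<v) (<⇒≤ v<x)))
                      (>⇒≢ (<-trans u<v v<x)) (>⇒≢ v<x)

  data Region (k : ℕ) : Set where
    before : k ≤ s → Region k
    first  : s < k → k ≤ toℕ u → Region k
    middle : toℕ u < k → k ≤ toℕ v → Region k
    after  : toℕ v < k → Region k

  region : ∀ k → Region k
  region k with k ≤? s | k ≤? toℕ u | k ≤? toℕ v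
  ... | yes k≤s | _       | _       = before k≤s
  ... | no k≰s  | yes k≤u | _       = first (≰⇒> k≰s) k≤u
  ... | no _    | no k≰u  | yes k≤v = middle (≰⇒> k≰u) k≤v
  ... | no _    | no _    | no k≰v  = after (≰⇒> k≰v)

module Transversal {n} (p q : Path n) where

  m : ℕ
  m = rkq q

  -- x ∈ A_{i+1} forces  i+1 ≤ countN q (x+1)  (q bounds every path in P[p,q]) ...
  A-upper : ∀ {i x} → A p q i x → suc (toℕ i) ≤ countN q (suc (toℕ x))
  A-upper (r , _ , r⪯q , _ , cr) = subst (_≤ countN q _) cr (proj₁ r⪯q _)

  -- ... and  countN p x ≤ i  (p bounds it from below).
  A-lower : ∀ {i x} → A p q i x → countN p (toℕ x) ≤ toℕ i
  A-lower {x = x} (r , p⪯r , _ , rx , cr) =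
    ≤-trans (proj₁ p⪯r (toℕ x)) (≤-reflexive (suc-injective (trans (sym (countN-stepN r x rx)) cr)))

  RankAtMost : Subset n → ℕ → Set
  RankAtMost X U = ∀ I → I ⊆ X → Indep p q I → ∣ I ∣ ≤ U

  RankAtLeast : Subset n → ℕ → Set
  RankAtLeast X U = Σ (Subset n) λ J → J ⊆ X × Indep p q J × U ≤ ∣ J ∣

  rank-intro : ∀ X U → RankAtLeast X U → RankAtMost X U → Rank p q X U
  rank-intro X U (J , J⊆X , J-ind , U≤J) ub = (J , J⊆X , J-ind , ≤-antisym (ub J J⊆X J-ind) U≤J) , ub

  flat-intro : ∀ X U → RankAtMost X U → (∀ e → e ∉ X → RankAtLeast (X ∪ ⁅ e ⁆) (suc U)) → Flat p q X
  flat-intro X U ub raise e e∉X r r' ((I , I⊆X , I-ind , ∣I∣≡r) , _) (_ , ub') with raise e e∉X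
  ... | J , J⊆ , J-ind , U<J =
    ≤-trans (s≤s (subst (_≤ U) ∣I∣≡r (ub I I⊆X I-ind))) (≤-trans U<J (ub' J J⊆ J-ind))

  total-bound : RankAtMost ⊤ m
  total-bound I _ (f , inj , _) = ≤-trans (injection-size I ⊤ f inj (λ _ _ → ∈⊤)) (≤-reflexive (∣⊤∣≡n m))

  prefix-bound : ∀ s → RankAtMost (below s) (countN q s)
  prefix-bound s I I⊆ (f , inj , inA) =
    ≤-trans (injection-size I (below (countN q s)) f inj early) (∣below∣≤ {m} (countN q s))
    where
    early : ∀ x → x ∈ I → f x ∈ below (countN q s)
    early x x∈I = below⁺ (f x) (≤-trans (A-upper (inA x x∈I)) (countN-mono q (below⁻ x (I⊆ x∈I))))

  prefix+1-bound : ∀ s k → RankAtMost (below s ∪ ⁅ k ⁆) (suc (countN q s))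
  prefix+1-bound s k I I⊆ (f , inj , inA) =
    ≤-trans (injection-size I (below c ∪ ⁅ f k ⁆) f inj into)
      (≤-trans (∣∪∣-≤ (below c) ⁅ f k ⁆)
        (≤-trans (+-monoˡ-≤ ∣ ⁅ f k ⁆ ∣ (∣below∣≤ {m} c))
          (≤-reflexive (trans (cong (c +_) (∣⁅x⁆∣≡1 (f k))) (+-comm c 1)))))
    where
    c : ℕ
    c = countN q s
    into : ∀ x → x ∈ I → f x ∈ (below c ∪ ⁅ f k ⁆)
    into x x∈I with x∈p∪q⁻ (below s) ⁅ k ⁆ (I⊆ x∈I)
    ... | inj₁ x<s = x∈p∪q⁺ (inj₁ (below⁺ (f x)
            (≤-trans (A-upper (inA x x∈I)) (countN-mono q (below⁻ x x<s)))))
    ... | inj₂ x≡k = x∈p∪q⁺ (inj₂ (subst (λ z → f z ∈ ⁅ f k ⁆) (sym (x∈⁅y⁆⇒x≡y k x≡k)) (x∈⁅x⁆ (f k))))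

earlyN : ∀ {n} → Path n → ℕ → Subset n
earlyN {zero}  r _ = []
earlyN {suc n} r zero = outside ∷ earlyN (r ∘ F.suc) zero
earlyN {suc n} r (suc s) with r F.zero
... | N = inside ∷ earlyN (r ∘ F.suc) s
... | E = outside ∷ earlyN (r ∘ F.suc) s

earlyN⁻ : ∀ {n} (r : Path n) s x → x ∈ earlyN r s → toℕ x < s × r x ≡ N
earlyN⁻ {suc n} r zero (F.suc x) (there x∈) with earlyN⁻ (r ∘ F.suc) zero x x∈
... | () , _
earlyN⁻ {suc n} r (suc s) x x∈ with r F.zero in r0 | x | x∈
... | N | F.zero  | _ = s≤s z≤n , r0
... | N | F.suc y | there y∈ = map₁ s≤s (earlyN⁻ (r ∘ F.suc) s y y∈)
... | E | F.suc y | there y∈ = map₁ s≤s (earlyN⁻ (r ∘ F.suc) s y y∈)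

∣earlyN∣ : ∀ {n} (r : Path n) s → ∣ earlyN r s ∣ ≡ countN r s
∣earlyN∣ {zero} r s = refl
∣earlyN∣ {suc n} r zero = trans (∣earlyN∣ (r ∘ F.suc) zero) (countN-zero (r ∘ F.suc))
∣earlyN∣ {suc n} r (suc s) with r F.zero
... | N = cong suc (∣earlyN∣ (r ∘ F.suc) s)
... | E = ∣earlyN∣ (r ∘ F.suc) s

-- Lower bounds: the early N-steps of q, each matched to its own set (as
-- witnessed by the path q itself), together with later elements X matched
-- injectively by g to later sets, form an independent set.
module Extension {n} (p q : Path n) (p⪯q : p ⪯ q) where
  open Transversal p q

  indexOf : ℕ → Fin m → Fin m
  indexOf k d with k <? m
  ... | yes k<m = fromℕ< k<m
  ... | no _    = d

  indexOf-val : ∀ k d → k < m → toℕ (indexOf k d) ≡ k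
  indexOf-val k d k<m with k <? m
  ... | yes k<m' = FP.toℕ-fromℕ< k<m'
  ... | no k≮m  = contradiction k<m k≮m

  ownIndex-val : ∀ x d → q x ≡ N → toℕ (indexOf (countN q (toℕ x)) d) ≡ countN q (toℕ x)
  ownIndex-val x d qx =
    indexOf-val _ d (≤-trans (≤-reflexive (sym (countN-stepN q x qx))) (countN-≤-total q _))

  own-set : ∀ x d → q x ≡ N → A p q (indexOf (countN q (toℕ x)) d) x
  own-set x d qx =
    q , p⪯q , ((λ _ → ≤-refl) , refl) , qx ,
    trans (countN-stepN q x qx) (cong suc (sym (ownIndex-val x d qx)))

  module Matching (s : ℕ) (X : Subset n) (g : Fin n → Fin m)
    (X-late : ∀ x → x ∈ X → s ≤ toℕ x)
    (g-inj : ∀ x y → x ∈ X → y ∈ X → g x ≡ g y → x ≡ y)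
    (g-late : ∀ x → x ∈ X → countN q s ≤ toℕ (g x))
    (g-A : ∀ x → x ∈ X → A p q (g x) x) where

    f : Fin n → Fin m
    f x with x ∈? X
    ... | yes _ = g x
    ... | no _  = indexOf (countN q (toℕ x)) (g x)

    f-late : ∀ x → x ∈ X → f x ≡ g x
    f-late x x∈X with x ∈? X
    ... | yes _   = refl
    ... | no x∉X = contradiction x∈X x∉X

    f-early : ∀ x → x ∉ X → f x ≡ indexOf (countN q (toℕ x)) (g x)
    f-early x x∉X with x ∈? X
    ... | yes x∈X = contradiction x∈X x∉X
    ... | no _    = refl

    f-early-val : ∀ x → x ∉ X → q x ≡ N → toℕ (f x) ≡ countN q (toℕ x)
    f-early-val x x∉X qx = trans (cong toℕ (f-early x x∉X)) (ownIndex-val x (g x) qx)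

    data Kind (x : Fin n) : Set where
      late  : x ∈ X → Kind x
      early : x ∉ X → toℕ x < s → q x ≡ N → Kind x

    kind : ∀ x → x ∈ earlyN q s ∪ X → Kind x
    kind x x∈ with x ∈? X
    ... | yes x∈X = late x∈X
    ... | no x∉X with x∈p∪q⁻ (earlyN q s) X x∈
    ...   | inj₁ x-early = early x∉X (proj₁ (earlyN⁻ q s x x-early)) (proj₂ (earlyN⁻ q s x x-early))
    ...   | inj₂ x∈X    = contradiction x∈X x∉X

    -- Early elements use indices below countN q s, late ones indices above.
    separated : ∀ x y → x ∉ X → toℕ x < s → q x ≡ N → y ∈ X → f x ≢ f y
    separated x y x∉X x<s qx y∈X fx≡fy =
      <⇒≱ (subst (_< countN q s) (sym (f-early-val x x∉X qx)) (countN-strict q x qx x<s))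
          (≤-trans (g-late y y∈X) (≤-reflexive (cong toℕ (sym (trans fx≡fy (f-late y y∈X))))))

    early-injective : ∀ x y → x ∉ X → q x ≡ N → y ∉ X → q y ≡ N → f x ≡ f y → x ≡ y
    early-injective x y x∉X qx y∉X qy fx≡fy = countN-injective q x y qx qy
      (trans (sym (f-early-val x x∉X qx)) (trans (cong toℕ fx≡fy) (f-early-val y y∉X qy)))

    injective : ∀ x y → x ∈ earlyN q s ∪ X → y ∈ earlyN q s ∪ X → f x ≡ f y → x ≡ y
    injective x y x∈ y∈ fx≡fy with kind x x∈ | kind y y∈
    ... | late x∈X | late y∈X =
      g-inj x y x∈X y∈X (trans (sym (f-late x x∈X)) (trans fx≡fy (f-late y y∈X)))
    ... | late x∈X | early y∉X y<s qy = contradiction (sym fx≡fy) (separated y x y∉X y<s qy x∈X)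
    ... | early x∉X x<s qx | late y∈X = contradiction fx≡fy (separated x y x∉X x<s qx y∈X)
    ... | early x∉X _ qx | early y∉X _ qy = early-injective x y x∉X qx y∉X qy fx≡fy

    in-sets : ∀ x → x ∈ earlyN q s ∪ X → A p q (f x) x
    in-sets x x∈ with kind x x∈
    ... | late x∈X = subst (λ i → A p q i x) (sym (f-late x x∈X)) (g-A x x∈X)
    ... | early x∉X _ qx = subst (λ i → A p q i x) (sym (f-early x x∉X)) (own-set x (g x) qx)

    size : ∣ earlyN q s ∪ X ∣ ≡ countN q s + ∣ X ∣
    size = trans (∣∪∣-disjoint (earlyN q s) X disjoint) (cong (_+ ∣ X ∣) (∣earlyN∣ q s))
      where
      disjoint : ∀ x → x ∈ earlyN q s → x ∉ X
      disjoint x x-early x∈X = <⇒≱ (proj₁ (earlyN⁻ q s x x-early)) (X-late x x∈X)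

  extend : ∀ s Y X (g : Fin n → Fin m) →
    (∀ x → x ∈ X → s ≤ toℕ x) →
    (∀ x y → x ∈ X → y ∈ X → g x ≡ g y → x ≡ y) →
    (∀ x → x ∈ X → countN q s ≤ toℕ (g x)) →
    (∀ x → x ∈ X → A p q (g x) x) →
    below s ⊆ Y → X ⊆ Y → RankAtLeast Y (countN q s + ∣ X ∣)
  extend s Y X g X-late g-inj g-late g-A below⊆Y X⊆Y =
    earlyN q s ∪ X , inside-Y , (f , injective , in-sets) , ≤-reflexive (sym size)
    where
    open Matching s X g X-late g-inj g-late g-A
    inside-Y : earlyN q s ∪ X ⊆ Y
    inside-Y {x} x∈ with x∈p∪q⁻ (earlyN q s) X x∈
    ... | inj₁ x-early = below⊆Y (below⁺ x (proj₁ (earlyN⁻ q s x x-early)))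
    ... | inj₂ x∈X    = X⊆Y x∈X

  atLeast-weaken : ∀ {Y U U'} → U ≤ U' → RankAtLeast Y U' → RankAtLeast Y U
  atLeast-weaken U≤U' (J , J⊆Y , J-ind , U'≤J) = J , J⊆Y , J-ind , ≤-trans U≤U' U'≤J

  -- The early N-steps alone (d is any index, needed only to have a matching).
  prefix-indep : ∀ s Y (d : Fin m) → below s ⊆ Y → RankAtLeast Y (countN q s)
  prefix-indep s Y d below⊆Y =
    atLeast-weaken (≤-reflexive (sym (trans (cong (countN q s +_) (∣⊥∣≡0 n)) (+-identityʳ _))))
      (extend s Y ⊥ (λ _ → d) (λ _ x∈ → contradiction x∈ ∉⊥) (λ _ _ x∈ → contradiction x∈ ∉⊥)
        (λ _ x∈ → contradiction x∈ ∉⊥) (λ _ x∈ → contradiction x∈ ∉⊥) below⊆Y (λ x∈ → contradiction x∈ ∉⊥))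

  prefix-indep+1 : ∀ s Y e (i : Fin m) → s ≤ toℕ e → countN q s ≤ toℕ i → A p q i e →
    below s ⊆ Y → e ∈ Y → RankAtLeast Y (suc (countN q s))
  prefix-indep+1 s Y e i s≤e c≤i e∈A below⊆Y e∈Y =
    atLeast-weaken (≤-reflexive (sym (trans (cong (countN q s +_) (∣⁅x⁆∣≡1 e)) (+-comm _ 1))))
      (extend s Y ⁅ e ⁆ (λ _ → i) (λ x x≡e → subst (λ z → s ≤ toℕ z) (sym (x∈⁅y⁆⇒x≡y e x≡e)) s≤e)
        (λ x y x≡e y≡e _ → trans (x∈⁅y⁆⇒x≡y e x≡e) (sym (x∈⁅y⁆⇒x≡y e y≡e))) (λ _ _ → c≤i)
        (λ x x≡e → subst (A p q i) (sym (x∈⁅y⁆⇒x≡y e x≡e)) e∈A) below⊆Y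
        (λ x≡e → subst (_∈ Y) (sym (x∈⁅y⁆⇒x≡y e x≡e)) e∈Y))

  prefix-indep+2 : ∀ s Y y w (iy iw : Fin m) → y ≢ w → iy ≢ iw →
    s ≤ toℕ y → s ≤ toℕ w → countN q s ≤ toℕ iy → countN q s ≤ toℕ iw →
    A p q iy y → A p q iw w → below s ⊆ Y → y ∈ Y → w ∈ Y →
    RankAtLeast Y (suc (suc (countN q s)))
  prefix-indep+2 s Y y w iy iw y≢w iy≢iw s≤y s≤w c≤iy c≤iw y∈A w∈A below⊆Y y∈Y w∈Y =
    atLeast-weaken (≤-reflexive (sym (trans (cong (countN q s +_) ∣pair∣) (+-comm _ 2))))
      (extend s Y pair g pair-late g-inj g-late g-A below⊆Y pair⊆Y)
    where
    pair : Subset n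
    pair = ⁅ y ⁆ ∪ ⁅ w ⁆

    pair⁻ : ∀ {x} → x ∈ pair → x ≡ y ⊎ x ≡ w
    pair⁻ x∈ with x∈p∪q⁻ ⁅ y ⁆ ⁅ w ⁆ x∈
    ... | inj₁ x≡y = inj₁ (x∈⁅y⁆⇒x≡y y x≡y)
    ... | inj₂ x≡w = inj₂ (x∈⁅y⁆⇒x≡y w x≡w)

    ∣pair∣ : ∣ pair ∣ ≡ 2
    ∣pair∣ = trans (∣∪∣-disjoint ⁅ y ⁆ ⁅ w ⁆
                     (λ x x≡y x≡w → y≢w (trans (sym (x∈⁅y⁆⇒x≡y y x≡y)) (x∈⁅y⁆⇒x≡y w x≡w))))
                   (cong₂ _+_ (∣⁅x⁆∣≡1 y) (∣⁅x⁆∣≡1 w))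

    g : Fin n → Fin m
    g x with x F.≟ y
    ... | yes _ = iy
    ... | no _  = iw

    g-y : g y ≡ iy
    g-y with y F.≟ y
    ... | yes _   = refl
    ... | no y≢y = contradiction refl y≢y

    g-w : g w ≡ iw
    g-w with w F.≟ y
    ... | yes w≡y = contradiction (sym w≡y) y≢w
    ... | no _    = refl

    pair-late : ∀ x → x ∈ pair → s ≤ toℕ x
    pair-late x x∈ with pair⁻ x∈
    ... | inj₁ refl = s≤y
    ... | inj₂ refl = s≤w

    g-inj : ∀ x z → x ∈ pair → z ∈ pair → g x ≡ g z → x ≡ z
    g-inj x z x∈ z∈ gx≡gz with pair⁻ x∈ | pair⁻ z∈
    ... | inj₁ refl | inj₁ refl = refl
    ... | inj₂ refl | inj₂ refl = refl
    ... | inj₁ refl | inj₂ refl = contradiction (trans (sym g-y) (trans gx≡gz g-w)) iy≢iw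
    ... | inj₂ refl | inj₁ refl = contradiction (trans (sym g-y) (trans (sym gx≡gz) g-w)) iy≢iw

    g-late : ∀ x → x ∈ pair → countN q s ≤ toℕ (g x)
    g-late x x∈ with pair⁻ x∈
    ... | inj₁ refl = subst (λ i → countN q s ≤ toℕ i) (sym g-y) c≤iy
    ... | inj₂ refl = subst (λ i → countN q s ≤ toℕ i) (sym g-w) c≤iw

    g-A : ∀ x → x ∈ pair → A p q (g x) x
    g-A x x∈ with pair⁻ x∈
    ... | inj₁ refl = subst (λ i → A p q i x) (sym g-y) y∈A
    ... | inj₂ refl = subst (λ i → A p q i x) (sym g-w) w∈A

    pair⊆Y : pair ⊆ Y
    pair⊆Y x∈ with pair⁻ x∈
    ... | inj₁ refl = y∈Y
    ... | inj₂ refl = w∈Y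

module LastTwoSteps {n} (p q : Path n) (p⪯q : p ⪯ q)
  (loopless : Loopless p q) (no-parallel : NoParallel p q)
  (j₁ j₂ : Fin n) (q-j₁ : q j₁ ≡ N) (j₁-last : ∀ k → q k ≡ N → toℕ k ≤ toℕ j₁)
  (q-j₂ : q j₂ ≡ N) (j₂<j₁ : toℕ j₂ < toℕ j₁)
  (j₂-second : ∀ k → q k ≡ N → k ≢ j₁ → toℕ k ≤ toℕ j₂) where

  open Transversal p q
  open Extension p q p⪯q

  c : ℕ
  c = countN q (toℕ j₂)

  count-after-j₂ : countN q (suc (toℕ j₂)) ≡ suc c
  count-after-j₂ = countN-stepN q j₂ q-j₂

  count-at-j₁ : countN q (toℕ j₁) ≡ suc c
  count-at-j₁ = trans (countN-constant q j₂<j₁ quiet) count-after-j₂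
    where
    quiet : ∀ x → suc (toℕ j₂) ≤ toℕ x → toℕ x < toℕ j₁ → q x ≢ N
    quiet x j₂<x x<j₁ qx = <⇒≱ j₂<x (j₂-second x qx (λ x≡j₁ → <⇒≢ x<j₁ (cong toℕ x≡j₁)))

  count-after-j₁ : countN q (suc (toℕ j₁)) ≡ suc (suc c)
  count-after-j₁ = trans (countN-stepN q j₁ q-j₁) (cong suc count-at-j₁)

  m≡c+2 : m ≡ suc (suc c)
  m≡c+2 = trans (countN-constant q (FP.toℕ<n j₁) quiet) count-after-j₁
    where
    quiet : ∀ x → suc (toℕ j₁) ≤ toℕ x → toℕ x < n → q x ≢ N
    quiet x j₁<x _ qx = <⇒≱ j₁<x (j₁-last x qx)

  index-bound : (i : Fin m) → toℕ i ≤ suc c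
  index-bound i = s≤s⁻¹ (subst (toℕ i <_) m≡c+2 (FP.toℕ<n i))

  -- The last two sets A_{c+1} and A_{c+2} (0-based indices c and c + 1).
  c<m : c < m
  c<m = subst (c <_) (sym m≡c+2) (n≤1+n (suc c))

  c+1<m : suc c < m
  c+1<m = subst (suc c <_) (sym m≡c+2) ≤-refl

  i₂ i₁ : Fin m
  i₂ = fromℕ< c<m
  i₁ = fromℕ< c+1<m

  i₂-val : toℕ i₂ ≡ c
  i₂-val = FP.toℕ-fromℕ< c<m

  i₁-val : toℕ i₁ ≡ suc c
  i₁-val = FP.toℕ-fromℕ< c+1<m

  i₂≢i₁ : i₂ ≢ i₁
  i₂≢i₁ i₂≡i₁ = <⇒≢ (n<1+n c) (trans (sym i₂-val) (trans (cong toℕ i₂≡i₁) i₁-val))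

  detour-sets : ∀ u v → toℕ j₂ ≤ toℕ u → toℕ u < toℕ v → toℕ j₁ ≤ toℕ v →
    countN p (toℕ u) ≤ c → countN p (toℕ v) ≤ suc c → A p q i₂ u × A p q i₁ v
  detour-sets u v j₂≤u u<v j₁≤v p-u p-v =
    (T , p⪯T , T⪯q , T-u , trans (count-middle _ (n<1+n _) u<v) (cong suc (sym i₂-val))) ,
    (T , p⪯T , T⪯q , T-v , trans (count-after _ (n<1+n _)) (cong suc (sym i₁-val)))
    where
    open Detour q (toℕ j₂) u v j₂≤u u<v

    count-total : countN T n ≡ m
    count-total = trans (count-after n (FP.toℕ<n v)) (sym m≡c+2)

    below-q : ∀ k → countN T k ≤ countN q k
    below-q k with region k
    ... | before k≤s     = ≤-reflexive (count-before k k≤s)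
    ... | first s<k k≤u  = ≤-trans (≤-reflexive (count-first k (<⇒≤ s<k) k≤u)) (countN-mono q (<⇒≤ s<k))
    ... | middle u<k k≤v = ≤-trans (≤-reflexive (trans (count-middle k u<k k≤v) (sym count-after-j₂)))
                                   (countN-mono q (≤-trans (s≤s j₂≤u) u<k))
    ... | after v<k      = ≤-trans (≤-reflexive (trans (count-after k v<k) (sym count-after-j₁)))
                                   (countN-mono q (≤-trans (s≤s j₁≤v) v<k))

    T⪯q : T ⪯ q
    T⪯q = below-q , count-total

    above-p : ∀ k → countN p k ≤ countN T k
    above-p k with region k
    ... | before k≤s     = ≤-trans (proj₁ p⪯q k) (≤-reflexive (sym (count-before k k≤s)))
    ... | first s<k k≤u  = ≤-trans (countN-mono p k≤u)
                                   (≤-trans p-u (≤-reflexive (sym (count-first k (<⇒≤ s<k) k≤u))))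
    ... | middle u<k k≤v = ≤-trans (countN-mono p k≤v)
                                   (≤-trans p-v (≤-reflexive (sym (count-middle k u<k k≤v))))
    ... | after v<k      = ≤-trans (countN-≤-total p k)
                                   (≤-reflexive (trans (proj₂ p⪯q) (trans m≡c+2 (sym (count-after k v<k)))))

    p⪯T : p ⪯ T
    p⪯T = above-p , trans (proj₂ p⪯q) (sym count-total)

  some-set : ∀ x → Σ (Fin m) λ i → A p q i x
  some-set x with loopless x
  ... | f , _ , inA = f x , inA x (x∈⁅x⁆ x)

  late-in-last : ∀ x → toℕ j₁ ≤ toℕ x → A p q i₁ x
  late-in-last x j₁≤x with some-set x
  ... | i , x∈A = proj₂ (detour-sets j₂ x ≤-refl (<-≤-trans j₂<j₁ j₁≤x) j₁≤x
                          (proj₁ p⪯q (toℕ j₂)) (≤-trans (A-lower x∈A) (index-bound i)))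

  middle-in-second : ∀ x → toℕ j₂ ≤ toℕ x → toℕ x < toℕ j₁ → A p q i₂ x
  middle-in-second x j₂≤x x<j₁ with some-set x
  ... | i , x∈A = proj₁ (detour-sets x j₁ j₂≤x x<j₁ ≤-refl (≤-trans (A-lower x∈A) i≤c)
                          (≤-trans (proj₁ p⪯q (toℕ j₁)) (≤-reflexive count-at-j₁)))
    where
    i≤c : toℕ i ≤ c
    i≤c = s≤s⁻¹ (≤-trans (A-upper x∈A) (≤-trans (countN-mono q x<j₁) (≤-reflexive count-at-j₁)))

  -- A late element in some A_i with i ≤ c also lies in A_{c+1}: its witness
  -- path has a further N-step z, and the detour through x and z works.
  late-shift : ∀ x (i : Fin m) → toℕ j₁ ≤ toℕ x → A p q i x → toℕ i ≤ c → A p q i₂ x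
  late-shift x i j₁≤x x∈A@(r , p⪯r , r⪯q , _ , r-x) i≤c
    with nextN r (suc (toℕ x)) (subst₂ _<_ (sym r-x) (sym (trans (proj₂ r⪯q) m≡c+2)) (s≤s (s≤s i≤c)))
  ... | z , x<z , _ , r-z =
    proj₁ (detour-sets x z (≤-trans (<⇒≤ j₂<j₁) j₁≤x) x<z (≤-trans j₁≤x (<⇒≤ x<z))
      (≤-trans (A-lower x∈A) i≤c)
      (≤-trans (proj₁ p⪯r (toℕ z)) (≤-trans (≤-reflexive (trans r-z r-x)) (s≤s i≤c))))

  index-cases : (i : Fin m) → toℕ i ≤ c ⊎ toℕ i ≡ suc c
  index-cases i with toℕ i ≤? c
  ... | yes i≤c = inj₁ i≤c
  ... | no i≰c  = inj₂ (≤-antisym (index-bound i) (≰⇒> i≰c))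

  beyond-j₂ : ∀ e → toℕ j₂ ≤ toℕ e → Σ (Fin m) λ i → c ≤ toℕ i × A p q i e
  beyond-j₂ e j₂≤e with toℕ e <? toℕ j₁
  ... | yes e<j₁ = i₂ , ≤-reflexive (sym i₂-val) , middle-in-second e j₂≤e e<j₁
  ... | no e≮j₁  = i₁ , ≤-trans (n≤1+n c) (≤-reflexive (sym i₁-val)) , late-in-last e (≮⇒≥ e≮j₁)

  -- For e < j₁ this is the placement above;
  -- for e ≥ j₁ the matching of {e, k} (M has no parallel elements) uses two
  -- distinct indices, so one of them is at most c and late-shift applies.
  pair-sets : ∀ e k → e ≢ k → toℕ j₂ ≤ toℕ e → toℕ j₁ ≤ toℕ k →
    (A p q i₂ e × A p q i₁ k) ⊎ (A p q i₁ e × A p q i₂ k)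
  pair-sets e k e≢k j₂≤e j₁≤k with toℕ e <? toℕ j₁
  ... | yes e<j₁ = inj₁ (middle-in-second e j₂≤e e<j₁ , late-in-last k j₁≤k)
  ... | no e≮j₁ with no-parallel e k e≢k
  ...   | g , g-inj , g-A with index-cases (g e) | index-cases (g k)
  ...     | inj₁ ge≤c | _ =
    inj₁ (late-shift e (g e) (≮⇒≥ e≮j₁) (g-A e (x∈p∪q⁺ (inj₁ (x∈⁅x⁆ e)))) ge≤c , late-in-last k j₁≤k)
  ...     | inj₂ _ | inj₁ gk≤c =
    inj₂ (late-in-last e (≮⇒≥ e≮j₁) , late-shift k (g k) j₁≤k (g-A k (x∈p∪q⁺ (inj₂ (x∈⁅x⁆ k)))) gk≤c)
  ...     | inj₂ ge≡c+1 | inj₂ gk≡c+1 =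
    contradiction (g-inj e k (x∈p∪q⁺ (inj₁ (x∈⁅x⁆ e))) (x∈p∪q⁺ (inj₂ (x∈⁅x⁆ k)))
                    (FP.toℕ-injective (trans ge≡c+1 (sym gk≡c+1)))) e≢k

  W Y : Subset n
  W = below (toℕ j₂)
  Y = below (toℕ j₁)

  W⊆Y : W ⊆ Y
  W⊆Y {x} x∈W = below⁺ x (<-trans (below⁻ x x∈W) j₂<j₁)

  W⊆W∪ : ∀ {Z} → W ⊆ W ∪ Z
  W⊆W∪ x∈W = x∈p∪q⁺ (inj₁ x∈W)

  late-∉W : ∀ k → toℕ j₁ ≤ toℕ k → k ∉ W
  late-∉W k j₁≤k k∈W = <⇒≱ (below⁻ k k∈W) (≤-trans (<⇒≤ j₂<j₁) j₁≤k)

  c≤i₂ : c ≤ toℕ i₂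
  c≤i₂ = ≤-reflexive (sym i₂-val)

  c≤i₁ : c ≤ toℕ i₁
  c≤i₁ = ≤-trans (n≤1+n c) (≤-reflexive (sym i₁-val))

  rank-E : Rank p q ⊤ m
  rank-E = rank-intro ⊤ m (prefix-indep n ⊤ i₂ (λ _ → ∈⊤)) total-bound

  rank-W : Rank p q W c
  rank-W = rank-intro W c (prefix-indep (toℕ j₂) W i₂ (λ x∈ → x∈)) (prefix-bound (toℕ j₂))

  Y-bound : RankAtMost Y (suc c)
  Y-bound I I⊆Y I-ind = ≤-trans (prefix-bound (toℕ j₁) I I⊆Y I-ind) (≤-reflexive count-at-j₁)

  rank-Y : Rank p q Y (suc c)
  rank-Y = rank-intro Y (suc c)
    (atLeast-weaken (≤-reflexive (sym count-at-j₁)) (prefix-indep (toℕ j₁) Y i₂ (λ x∈ → x∈))) Y-bound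

  rank-Wk : ∀ k → toℕ j₁ ≤ toℕ k → Rank p q (W ∪ ⁅ k ⁆) (suc c)
  rank-Wk k j₁≤k = rank-intro (W ∪ ⁅ k ⁆) (suc c)
    (prefix-indep+1 (toℕ j₂) (W ∪ ⁅ k ⁆) k i₁ (≤-trans (<⇒≤ j₂<j₁) j₁≤k) c≤i₁ (late-in-last k j₁≤k)
      W⊆W∪ (x∈p∪q⁺ (inj₂ (x∈⁅x⁆ k))))
    (prefix+1-bound (toℕ j₂) k)

  -- An element e ∉ W lies in a set of index ≥ c, so W ∪ {e} has rank c + 1.
  flat-W : Flat p q W
  flat-W = flat-intro W c (prefix-bound (toℕ j₂)) raise
    where
    raise : ∀ e → e ∉ W → RankAtLeast (W ∪ ⁅ e ⁆) (suc c)
    raise e e∉W with beyond-j₂ e (∉below e e∉W)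
    ... | i , c≤i , e∈A =
      prefix-indep+1 (toℕ j₂) (W ∪ ⁅ e ⁆) e i (∉below e e∉W) c≤i e∈A W⊆W∪ (x∈p∪q⁺ (inj₂ (x∈⁅x⁆ e)))

  -- An element e ∉ Y lies in the last set, so Y ∪ {e} has rank c + 2.
  flat-Y : Flat p q Y
  flat-Y = flat-intro Y (suc c) Y-bound raise
    where
    raise : ∀ e → e ∉ Y → RankAtLeast (Y ∪ ⁅ e ⁆) (suc (suc c))
    raise e e∉Y = atLeast-weaken (≤-reflexive (cong suc (sym count-at-j₁)))
      (prefix-indep+1 (toℕ j₁) (Y ∪ ⁅ e ⁆) e i₁ (∉below e e∉Y)
        (≤-reflexive (trans count-at-j₁ (sym i₁-val))) (late-in-last e (∉below e e∉Y))
        (λ x∈Y → x∈p∪q⁺ (inj₁ x∈Y)) (x∈p∪q⁺ (inj₂ (x∈⁅x⁆ e))))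

  -- An element e ∉ W ∪ {k} and k fill the last two sets (pair-sets), so
  -- W ∪ {k, e} has rank c + 2.
  flat-Wk : ∀ k → toℕ j₁ ≤ toℕ k → Flat p q (W ∪ ⁅ k ⁆)
  flat-Wk k j₁≤k = flat-intro (W ∪ ⁅ k ⁆) (suc c) (prefix+1-bound (toℕ j₂) k) raise
    where
    j₂≤k : toℕ j₂ ≤ toℕ k
    j₂≤k = ≤-trans (<⇒≤ j₂<j₁) j₁≤k

    raise : ∀ e → e ∉ W ∪ ⁅ k ⁆ → RankAtLeast ((W ∪ ⁅ k ⁆) ∪ ⁅ e ⁆) (suc (suc c))
    raise e e∉ = place (pair-sets e k e≢k j₂≤e j₁≤k)
      where
      e≢k : e ≢ k
      e≢k e≡k = e∉ (x∈p∪q⁺ (inj₂ (subst (_∈ ⁅ k ⁆) (sym e≡k) (x∈⁅x⁆ k))))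

      j₂≤e : toℕ j₂ ≤ toℕ e
      j₂≤e = ∉below e (λ e∈W → e∉ (x∈p∪q⁺ (inj₁ e∈W)))

      W⊆ : W ⊆ (W ∪ ⁅ k ⁆) ∪ ⁅ e ⁆
      W⊆ x∈W = x∈p∪q⁺ (inj₁ (W⊆W∪ x∈W))

      k∈ : k ∈ (W ∪ ⁅ k ⁆) ∪ ⁅ e ⁆
      k∈ = x∈p∪q⁺ (inj₁ (x∈p∪q⁺ (inj₂ (x∈⁅x⁆ k))))

      e∈ : e ∈ (W ∪ ⁅ k ⁆) ∪ ⁅ e ⁆
      e∈ = x∈p∪q⁺ (inj₂ (x∈⁅x⁆ e))

      place : (A p q i₂ e × A p q i₁ k) ⊎ (A p q i₁ e × A p q i₂ k) →
        RankAtLeast ((W ∪ ⁅ k ⁆) ∪ ⁅ e ⁆) (suc (suc c))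
      place (inj₁ (e∈A , k∈A)) = prefix-indep+2 (toℕ j₂) _ e k i₂ i₁ e≢k i₂≢i₁
                                   j₂≤e j₂≤k c≤i₂ c≤i₁ e∈A k∈A W⊆ e∈ k∈
      place (inj₂ (e∈A , k∈A)) = prefix-indep+2 (toℕ j₂) _ k e i₂ i₁ (≢-sym e≢k) i₂≢i₁
                                   j₂≤k j₂≤e c≤i₂ c≤i₁ k∈A e∈A W⊆ k∈ e∈

  coline-W : Coline p q W
  coline-W = flat-W , m , rank-E , subst (Rank p q W) (sym (cong (_∸ 2) m≡c+2)) rank-W

  copoint-Y : CopointOn p q W Y
  copoint-Y = flat-Y , W⊆Y , m , rank-E , subst (Rank p q Y) (sym (cong (_∸ 1) m≡c+2)) rank-Y

  copoint-Wk : ∀ k → toℕ j₁ ≤ toℕ k → CopointOn p q W (W ∪ ⁅ k ⁆)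
  copoint-Wk k j₁≤k =
    flat-Wk k j₁≤k , W⊆W∪ , m , rank-E , subst (Rank p q (W ∪ ⁅ k ⁆)) (sym (cong (_∸ 1) m≡c+2)) (rank-Wk k j₁≤k)

mainTheorem3 : ∀ {n} (p q : Path n) → p ⪯ q →
    Loopless p q → NoParallel p q →
    Σ ℕ (λ r → Rank p q ⊤ r × 2 ≤ r) →
    (j₁ j₂ : Fin n) →
    q j₁ ≡ N → (∀ k → q k ≡ N → toℕ k ≤ toℕ j₁) →
    q j₂ ≡ N → toℕ j₂ < toℕ j₁ →
    (∀ k → q k ≡ N → k ≢ j₁ → toℕ k ≤ toℕ j₂) →
    Coline p q (below (toℕ j₂))
    × (CopointOn p q (below (toℕ j₂)) (below (toℕ j₁))
       × (2 + toℕ j₂ ≤ toℕ j₁ →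
          MultipleCopointOn p q (below (toℕ j₂)) (below (toℕ j₁))))
    × (∀ k → toℕ j₁ ≤ toℕ k →
         SimpleCopointOn p q (below (toℕ j₂)) (below (toℕ j₂) ∪ ⁅ k ⁆))
mainTheorem3 p q p⪯q loopless no-parallel _ j₁ j₂ q-j₁ j₁-last q-j₂ j₂<j₁ j₂-second =
  coline-W ,
  (copoint-Y , λ gap → copoint-Y , below-gap j₂ j₁ gap) ,
  (λ k j₁≤k → copoint-Wk k j₁≤k , added-one W k (late-∉W k j₁≤k))
  where
  open LastTwoSteps p q p⪯q loopless no-parallel j₁ j₂ q-j₁ j₁-last q-j₂ j₂<j₁ j₂-second
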